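{- $\mathrm{IS}^0{:}B(2n+3)\subsetneq\mathrm{IS}^1{:}B(2n+3)$.
   Context: Booleans are $\mathrm{F}$ and $\mathrm{T}$. An instruction sequence is a finite sequence $u_1;u_2;\dots;u_k$ of primitive instructions; its length is $k$. Basic instructions are: $\mathrm{in}{:}i.\mathrm{get}$ ($i\ge1$), $\mathrm{out}.\mathrm{set}{:}b$ ($b\in\{\mathrm{F},\mathrm{T}\}$), $\mathrm{aux}{:}i.\mathrm{get}$, $\mathrm{aux}{:}i.\mathrm{set}{:}b$, $\mathrm{aux}{:}i.\mathrm{com}$ ($i\ge1$). Each names a Boolean register ($\mathrm{in}{:}i$ input, $\mathrm{out}$ output, $\mathrm{aux}{:}i$ auxiliary) and a command: $\mathrm{get}$ leaves the register unchanged and replies its content; $\mathrm{set}{:}b$ sets the content to $b$ and replies $b$; $\mathrm{com}$ complements the content and replies the new content. Primitive instructions: for each basic instruction $a$, plain $a$, positive test ${+}a$, negative test ${ - }a$; forward jumps $\#l$ ($l\in\mathbb{N}$); termination $!$. Execution starts at $u_1$. ${+}a$ executes $a$ and proceeds with the next instruction if the reply is $\mathrm{T}$, otherwise skips the next instruction and proceeds with the one after; ${ - }a$ likewise with replies reversed; plain $a$ executes $a$ and proceeds with the next instruction; $\#l$ proceeds with the $l$th next instruction; $!$ terminates. If $l=0$ or there is no instruction to proceed with, inaction occurs (no termination). $X$ computes $f:\{\mathrm{F},\mathrm{T}\}^n\to\{\mathrm{F},\mathrm{T}\}$ if there is $k\in\mathbb{N}$ (at least every auxiliary index used in $X$) such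 that for all $b_1,\dots,b_n$: starting with $\mathrm{in}{:}i$ containing $b_i$, $\mathrm{out}$ containing $\mathrm{F}$, and $\mathrm{aux}{:}1,\dots,\mathrm{aux}{:}k$ containing $\mathrm{F}$, execution terminates with $\mathrm{out}$ containing $f(b_1,\dots,b_n)$. $\mathrm{IS}^k$ denotes the set of instruction sequences in which no instruction of the form $\mathrm{aux}{:}i.c$, ${+}\mathrm{aux}{:}i.c$, ${ - }\mathrm{aux}{:}i.c$ with $i>k$ occurs. For a set $\mathcal{I}$ of instruction sequences and $f:\mathbb{N}\to\mathbb{N}$, $\mathcal{I}{:}B(f(n))$ is the class of Boolean function families $(f_n)_{n\in\mathbb{N}}$ ($f_n$ an $n$-ary Boolean function) for which there exists $h:\mathbb{N}\to\mathbb{N}$ with $h(n)\le f(n)$ for all sufficiently large $n$ such that for all $n$ there is $X\in\mathcal{I}$ computing $f_n$ with length at most $h(n)$. $\subsetneq$ denotes proper inclusion. -}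

module Defs where

open import Data.Bool using (Bool; true; false; if_then_else_; not)
open import Data.Nat using (ℕ; zero; suc; _+_; _*_; _≤_; _<_; _≡ᵇ_)
open import Data.List using (List; []; _∷_; length)
open import Data.List.Relation.Unary.All using (All)
open import Data.Vec using (Vec; []; _∷_)
open import Data.Maybe using (Maybe; just; nothing)
open import Data.Product using (_×_; _,_; ∃; Σ)
open import Data.Unit using (⊤)
open import Relation.Binary.PropositionalEquality using (_≡_)
open import Relation.Nullary using (¬_)

-- Booleans: F = false, T = true.
-- Register indices: the natural number j stands for register index j+1
-- (so in:1 is encoded by 0, aux:1 by 0, etc.), matching i ≥ 1.

data Basic : Set where
  inGet  : ℕ → Basic
  outSet : Bool → Basic
  auxGet : ℕ → Basic
  auxSet : ℕ → Bool → Basic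
  auxCom : ℕ → Basic

data Instr : Set where
  plain : Basic → Instr
  ptest : Basic → Instr
  ntest : Basic → Instr
  jump  : ℕ → Instr
  halt  : Instr

InstrSeq : Set
InstrSeq = List Instr

record State : Set where
  constructor mkState
  field
    inputs : ℕ → Bool
    out    : Bool
    aux    : ℕ → Bool
open State public

updAux : (ℕ → Bool) → ℕ → Bool → (ℕ → Bool)
updAux f j b m = if m ≡ᵇ j then b else f m

execBasic : Basic → State → State × Bool
execBasic (inGet j)    s = s , inputs s j
execBasic (outSet b)   s = mkState (inputs s) b (aux s) , b
execBasic (auxGet j)   s = s , aux s j
execBasic (auxSet j b) s = mkState (inputs s) (out s) (updAux (aux s) j b) , b
execBasic (auxCom j)   s =
  mkState (inputs s) (out s) (updAux (aux s) j (not (aux s j))) , not (aux s j)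

nth : {A : Set} → List A → ℕ → Maybe A
nth []       _       = nothing
nth (x ∷ xs) zero    = just x
nth (x ∷ xs) (suc k) = nth xs k

-- configuration: current position (0-based) and register state
Config : Set
Config = ℕ × State

data Outcome : Set where
  halted   : State → Outcome
  continue : Config → Outcome
  inaction : Outcome

step : InstrSeq → Config → Outcome
step X (pc , s) with nth X pc
... | nothing = inaction
... | just (plain a) with execBasic a s
...   | (s' , _) = continue (suc pc , s')
step X (pc , s) | just (ptest a) with execBasic a s
...   | (s' , r) = continue ((if r then suc pc else suc (suc pc)) , s')
step X (pc , s) | just (ntest a) with execBasic a s
...   | (s' , r) = continue ((if r then suc (suc pc) else suc pc) , s')
step X (pc , s) | just (jump zero)    = inaction
step X (pc , s) | just (jump (suc l)) = continue (pc + suc l , s)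
step X (pc , s) | just halt           = halted s

run : InstrSeq → ℕ → Config → Maybe State
run X zero    c = nothing
run X (suc k) c with step X c
... | halted s   = just s
... | continue c' = run X k c'
... | inaction   = nothing

inputVal : {n : ℕ} → Vec Bool n → ℕ → Bool
inputVal []       _       = false
inputVal (x ∷ xs) zero    = x
inputVal (x ∷ xs) (suc j) = inputVal xs j

initState : {n : ℕ} → Vec Bool n → State
initState b = mkState (inputVal b) false (λ _ → false)

Computes : {n : ℕ} → InstrSeq → (Vec Bool n → Bool) → Set
Computes X f = ∀ b → ∃ λ k → ∃ λ s →
  run X k (0 , initState b) ≡ just s × out s ≡ f b

auxOK : ℕ → Basic → Set
auxOK k (inGet _)    = ⊤
auxOK k (outSet _)   = ⊤
auxOK k (auxGet j)   = j < k
auxOK k (auxSet j _) = j < k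
auxOK k (auxCom j)   = j < k

InstrOK : ℕ → Instr → Set
InstrOK k (plain a) = auxOK k a
InstrOK k (ptest a) = auxOK k a
InstrOK k (ntest a) = auxOK k a
InstrOK k (jump _)  = ⊤
InstrOK k halt      = ⊤

IS : ℕ → InstrSeq → Set
IS k X = All (InstrOK k) X

BoolFamily : Set
BoolFamily = (n : ℕ) → Vec Bool n → Bool

B : (InstrSeq → Set) → (ℕ → ℕ) → BoolFamily → Set
B I g fam = Σ (ℕ → ℕ) λ h →
  (∃ λ N → ∀ n → N ≤ n → h n ≤ g n) ×
  (∀ n → ∃ λ X → I X × Computes X (fam n) × length X ≤ h n)

_⊊_ : (BoolFamily → Set) → (BoolFamily → Set) → Set
P ⊊ Q = (∀ fam → P fam → Q fam) × (∃ λ fam → Q fam × ¬ P fam)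

linBound : ℕ → ℕ
linBound n = 2 * n + 3

module Submission where

open import Defs
open import Algebra.Bundles using (CommutativeRing)
import Algebra.Solver.CommutativeMonoid as CommutativeMonoidSolver
open import Data.Bool using (Bool; true; false; not; _xor_; if_then_else_; T)
open import Data.Bool.Properties
  using (not-involutive; not-¬; xor-comm; xor-assoc; xor-inverseʳ; xor-annihilates-not;
         not-distribˡ-xor; not-distribʳ-xor; xor-∧-commutativeRing)
open import Data.Bool.ListAction using (any)
open import Data.Nat using (ℕ; zero; suc; _+_; _*_; _≤_; _<_; s≤s; z≤n; _<ᵇ_; _≡ᵇ_)
open import Data.Nat.Properties
  using (_≟_; _<?_; _≤?_; <ᵇ⇒<; <⇒<ᵇ; ≡ᵇ⇒≡; ≡⇒≡ᵇ; ≤-refl; ≤-reflexive; ≤-trans; <-≤-trans; ≤-pred; ≮⇒≥;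
         ≰⇒>; ≤∧≢⇒<; <⇒≢; <-irrefl; 1+n≰n; n≤1+n; m≤m+n; m≤n+m; +-suc; +-assoc; +-comm;
         +-identityʳ; +-monoʳ-≤; +-monoˡ-≤; suc-injective; module ≤-Reasoning)
open import Data.Nat.Tactic.RingSolver using (solve-∀)
open import Data.Vec using (Vec; []; _∷_; replicate)
open import Data.Maybe using (Maybe; just; nothing; _>>=_)
import Data.Maybe as Maybe
open import Data.Product using (_×_; _,_; proj₁; proj₂; ∃)
open import Data.Sum using (_⊎_; inj₁; inj₂)
import Data.Sum as Sum
open import Data.Empty using (⊥; ⊥-elim)
open import Data.List using (List; []; _∷_; _++_; length; map; cartesianProductWith; upTo)
open import Data.List.Relation.Unary.All using (All; []; _∷_; zipWith)
import Data.List.Relation.Unary.All as All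
open import Data.List.Relation.Unary.All.Properties using (¬Any⇒All¬)
import Data.List.Relation.Unary.Any as Any
open import Data.List.Relation.Unary.Any.Properties using (any⁺)
open import Data.List.Membership.Propositional using () renaming (_∈_ to _∈ˡ_)
open import Data.List.Membership.Propositional.Properties
  using (∈-++⁺ˡ; ∈-++⁺ʳ; ∈-map⁺; ∈-cartesianProductWith⁺; ∈-upTo⁺)
open import Data.List.Fresh using (List#; []; cons; _#_)
import Data.List.Fresh as Fresh
open import Data.List.Fresh.Relation.Unary.Any using (here; there; _─_; any?)
open import Data.List.Fresh.Relation.Unary.Any.Properties using (length-remove)
open import Function using (id; _∘_)
open import Relation.Nullary using (¬_; Dec; yes; no)
open import Relation.Binary.PropositionalEquality
open import Relation.Binary.PropositionalEquality.Properties using (setoid)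
open import Data.List.Fresh.Membership.Setoid (setoid ℕ) using (_∈_; _∉_)
open import Data.List.Fresh.Membership.Setoid.Properties (setoid ℕ) using (∉-remove)

-- Upper bound: with the auxiliary register aux:1, a test of each input
-- followed by a complement of aux:1, and three instructions copying aux:1 to
-- the output, compute the parity of n inputs with 2n+3 instructions.
-- Lower bound: without auxiliary registers the only memory is the output
-- register.  If a program computes parity on a subcube (some inputs fixed,
-- those in a set F free) from a position s, its run reaches a test of a free
-- input, since otherwise the output would be constant on the subcube.  Fixing
-- that input to the value for which the test skips, the program computes
-- parity on a smaller subcube from two positions further on.  Two free inputs
-- cost eight instructions: otherwise the seven instructions after the first
-- free test would form an abstract two-input program for xor, and an
-- exhaustive search, run by evaluation, shows there is none.  So parity of
-- n ≥ 2 inputs needs 2n+4 instructions in IS⁰.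

-- `agree r q`: a test with polarity q (T for +a, F for -a) whose reply is r
-- proceeds with the next instruction exactly when this is T.
agree : Bool → Bool → Bool
agree true  q = q
agree false q = not q

agree-self : ∀ q → agree q q ≡ true
agree-self true  = refl
agree-self false = refl

agree-not : ∀ q → agree (not q) q ≡ false
agree-not true  = refl
agree-not false = refl

agree-involutive : ∀ v q → agree (agree v q) q ≡ v
agree-involutive true  true  = refl
agree-involutive true  false = refl
agree-involutive false true  = refl
agree-involutive false false = refl

agree-relative : ∀ r q q₀ → agree r q ≡ agree (agree r q₀) (agree q q₀)
agree-relative true  true  true  = refl
agree-relative true  true  false = refl
agree-relative true  false true  = refl
agree-relative true  false false = refl
agree-relative false true  true  = refl
agree-relative false true  false = refl
agree-relative false false true  = refl
agree-relative false false false = refl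

agree-xor : ∀ v q → agree v q ≡ v xor not q
agree-xor true  q = sym (not-involutive q)
agree-xor false q = refl

next : Bool → ℕ → ℕ
next true  p = suc p
next false p = suc (suc p)

≤-next : ∀ g p → p ≤ next g p
≤-next true  p = n≤1+n p
≤-next false p = ≤-trans (n≤1+n p) (n≤1+n (suc p))

+-next : ∀ t g p → t + next g p ≡ next g (t + p)
+-next t true  p = +-suc t p
+-next t false p = trans (+-suc t (suc p)) (cong suc (+-suc t p))

Test : Bool → Basic → Instr
Test true  = ptest
Test false = ntest

parity : ∀ {n} → Vec Bool n → Bool
parity []       = false
parity (x ∷ xs) = x xor parity xs

assign : ∀ {n} → Vec Bool n → ℕ → Bool → Vec Bool n
assign []       _       _ = []
assign (x ∷ xs) zero    v = v ∷ xs
assign (x ∷ xs) (suc a) v = x ∷ assign xs a v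

assign-same : ∀ {n} (x : Vec Bool n) a v → a < n → inputVal (assign x a v) a ≡ v
assign-same (x ∷ xs) zero    v _         = refl
assign-same (x ∷ xs) (suc a) v (s≤s a<n) = assign-same xs a v a<n

assign-other : ∀ {n} (x : Vec Bool n) a v j → j ≢ a → inputVal (assign x a v) j ≡ inputVal x j
assign-other []       a       v j       _   = refl
assign-other (x ∷ xs) zero    v zero    j≢a = ⊥-elim (j≢a refl)
assign-other (x ∷ xs) zero    v (suc j) _   = refl
assign-other (x ∷ xs) (suc a) v zero    _   = refl
assign-other (x ∷ xs) (suc a) v (suc j) j≢a = assign-other xs a v j (j≢a ∘ cong suc)

parity-assign : ∀ {n} (x : Vec Bool n) a v → a < n →
                parity (assign x a v) ≡ parity x xor (inputVal x a xor v)
parity-assign (x ∷ xs) zero v _ = trans (xor-comm v (parity xs)) (sym (cancel x))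
  where
  cancel : ∀ x → (x xor parity xs) xor (x xor v) ≡ parity xs xor v
  cancel false = refl
  cancel true  = xor-annihilates-not (parity xs) v
parity-assign (x ∷ xs) (suc a) v (s≤s a<n) =
  trans (cong (x xor_) (parity-assign xs a v a<n)) (sym (xor-assoc x (parity xs) _))

parity-flip : ∀ {n} (x : Vec Bool n) a → a < n → parity (assign x a (not (inputVal x a))) ≢ parity x
parity-flip x a a<n eq = not-¬ eq flipped
  where
  flipped : parity (assign x a (not (inputVal x a))) ≡ not (parity x)
  flipped = trans (parity-assign x a _ a<n)
                  (trans (cong (parity x xor_) (xor-inverseʳ (inputVal x a))) (xor-comm (parity x) true))

module _ (X : InstrSeq) {p : ℕ} {s : State} where

  step-nothing : nth X p ≡ nothing → step X (p , s) ≡ inaction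
  step-nothing e rewrite e = refl

  step-halt : nth X p ≡ just halt → step X (p , s) ≡ halted s
  step-halt e rewrite e = refl

  step-jump0 : nth X p ≡ just (jump zero) → step X (p , s) ≡ inaction
  step-jump0 e rewrite e = refl

  step-jump : ∀ {l} → nth X p ≡ just (jump (suc l)) → step X (p , s) ≡ continue (p + suc l , s)
  step-jump e rewrite e = refl

  step-plain : ∀ {a} → nth X p ≡ just (plain a) → step X (p , s) ≡ continue (suc p , proj₁ (execBasic a s))
  step-plain e rewrite e = refl

  step-test : ∀ q {a} → nth X p ≡ just (Test q a) →
              step X (p , s) ≡ continue (next (agree (proj₂ (execBasic a s)) q) p , proj₁ (execBasic a s))
  step-test true  {a} e rewrite e with proj₂ (execBasic a s)
  ... | true  = refl
  ... | false = refl
  step-test false {a} e rewrite e with proj₂ (execBasic a s)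
  ... | true  = refl
  ... | false = refl

module _ (X : InstrSeq) {k : ℕ} {c : Config} where

  run-continue : ∀ {c'} → step X c ≡ continue c' → run X (suc k) c ≡ run X k c'
  run-continue e rewrite e = refl

  run-halted : ∀ {s} → step X c ≡ halted s → run X (suc k) c ≡ just s
  run-halted e rewrite e = refl

  run-inaction : step X c ≡ inaction → run X (suc k) c ≡ nothing
  run-inaction e rewrite e = refl

nth-beyond : ∀ {A : Set} (xs : List A) p → length xs ≤ p → nth xs p ≡ nothing
nth-beyond []       p       _         = refl
nth-beyond (x ∷ xs) (suc p) (s≤s le) = nth-beyond xs p le

data AuxFree : Instr → Set where
  read     : ∀ j → AuxFree (plain (inGet j))
  write    : ∀ v → AuxFree (plain (outSet v))
  test-in  : ∀ q j → AuxFree (Test q (inGet j))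
  test-out : ∀ q v → AuxFree (Test q (outSet v))
  goto     : ∀ l → AuxFree (jump l)
  stop     : AuxFree halt

auxFree : ∀ i → InstrOK 0 i → AuxFree i
auxFree (plain (inGet j))  _  = read j
auxFree (plain (outSet v)) _  = write v
auxFree (plain (auxGet _))   ()
auxFree (plain (auxSet _ _)) ()
auxFree (plain (auxCom _))   ()
auxFree (ptest (inGet j))  _  = test-in true j
auxFree (ptest (outSet v)) _  = test-out true v
auxFree (ptest (auxGet _))   ()
auxFree (ptest (auxSet _ _)) ()
auxFree (ptest (auxCom _))   ()
auxFree (ntest (inGet j))  _  = test-in false j
auxFree (ntest (outSet v)) _  = test-out false v
auxFree (ntest (auxGet _))   ()
auxFree (ntest (auxSet _ _)) ()
auxFree (ntest (auxCom _))   ()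
auxFree (jump l)           _  = goto l
auxFree halt               _  = stop

auxFree-at : ∀ {X} p {i} → IS 0 X → nth X p ≡ just i → AuxFree i
auxFree-at zero    {i} (ok ∷ _)  refl = auxFree i ok
auxFree-at (suc p)     (_ ∷ oks) e    = auxFree-at p oks e

Vars : Set
Vars = List# ℕ _≢_

_∈?_ : ∀ j (F : Vars) → Dec (j ∈ F)
j ∈? F = any? (j ≟_) F

∈-─⁻ : ∀ {j a} {F : Vars} (a∈F : a ∈ F) → j ∈ (F ─ a∈F) → j ∈ F
∈-─⁻ (here _)   j∈         = there j∈
∈-─⁻ (there _)  (here e)   = here e
∈-─⁻ (there a∈) (there j∈) = there (∈-─⁻ a∈ j∈)

another : ∀ {a} (F : Vars) → Fresh.length F ≡ 2 → a ∈ F → ∃ λ b → b ∈ F × a ≢ b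
another F size a∈F = other (F ─ a∈F) (trans (sym size) (length-remove a∈F)) (∉-remove id id a∈F) (∈-─⁻ a∈F)
  where
  other : ∀ {a} (R : Vars) → 2 ≡ suc (Fresh.length R) → a ∉ R → (∀ {j} → j ∈ R → j ∈ F) →
          ∃ λ b → b ∈ F × a ≢ b
  other (cons b [] _) _ a∉R R⊆F = b , R⊆F (here refl) , λ { refl → a∉R (here refl) }

-- The set of the variables 0, …, n-1, which are distinct since each new
-- one exceeds the previous ones.
mutual
  below : ℕ → Vars
  below zero    = []
  below (suc n) = cons n (below n) (below-fresh ≤-refl)

  below-fresh : ∀ {m n} → n ≤ m → m # below n
  below-fresh {n = zero}  _   = _
  below-fresh {n = suc n} n<m = (λ m≡n → <⇒≢ n<m (sym m≡n)) , below-fresh (≤-trans (n≤1+n n) n<m)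

Bounded : ℕ → Vars → Set
Bounded n F = ∀ {j} → j ∈ F → j < n

length-below : ∀ n → Fresh.length (below n) ≡ n
length-below zero    = refl
length-below (suc n) = cong suc (length-below n)

below-bound : ∀ n → Bounded n (below n)
below-bound (suc n) (here refl) = ≤-refl
below-bound (suc n) (there j∈)  = ≤-trans (below-bound n j∈) (n≤1+n n)

-- The state with inputs x, output o and all auxiliary registers F; a
-- program in IS⁰ only ever changes the output.
stateOf : ∀ {n} → Vec Bool n → Bool → State
stateOf x o = mkState (inputVal x) o (λ _ → false)

InSubcube : ∀ {n} → Vars → Vec Bool n → Vec Bool n → Set
InSubcube F y x = ∀ j → j ∉ F → inputVal x j ≡ inputVal y j

centre : ∀ {n F} (y : Vec Bool n) → InSubcube F y y
centre y _ _ = refl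

module Subcubes (X : InstrSeq) (isX : IS 0 X) {n : ℕ} where

  HaltsWithParity : ℕ → Bool → Vec Bool n → Set
  HaltsWithParity s o x = ∃ λ k → ∃ λ st → run X k (s , stateOf x o) ≡ just st × out st ≡ parity x

  ParityOn : ℕ → Bool → Vec Bool n → Vars → Set
  ParityOn s o y F = ∀ x → InSubcube F y x → HaltsWithParity s o x

  halts-continue : ∀ x {s o s' o'} → step X (s , stateOf x o) ≡ continue (s' , stateOf x o') →
                   HaltsWithParity s o x → HaltsWithParity s' o' x
  halts-continue x moved (suc k , st , h , res) = k , st , trans (sym (run-continue X moved)) h , res

  halts-inaction : ∀ x {s o} → step X (s , stateOf x o) ≡ inaction → ¬ HaltsWithParity s o x
  halts-inaction x stuck (suc k , st , h , res) with trans (sym (run-inaction X stuck)) h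
  ... | ()

  halts-halt : ∀ x {s o} → nth X s ≡ just halt → HaltsWithParity s o x → o ≡ parity x
  halts-halt x at (suc k , st , h , res) with trans (sym (run-halted X (step-halt X at))) h
  ... | refl = res

  parityOn-step : ∀ {s o s' o' y F} →
                  (∀ x → InSubcube F y x → step X (s , stateOf x o) ≡ continue (s' , stateOf x o')) →
                  ParityOn s o y F → ParityOn s' o' y F
  parityOn-step uniform par x inx = halts-continue x (uniform x inx) (par x inx)

  record FreeTest (s : ℕ) (y : Vec Bool n) (F : Vars) : Set where
    constructor freeTest
    field
      pos      : ℕ
      s≤pos    : s ≤ pos
      var      : ℕ
      var∈F    : var ∈ F
      polarity : Bool
      at       : nth X pos ≡ just (Test polarity (inGet var))
      output   : Bool
      computes : ParityOn pos output y F

  later : ∀ {s s' y F} → s ≤ s' → FreeTest s' y F → FreeTest s y F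
  later s≤s' (freeTest p s'≤p a a∈F q at o par) = freeTest p (≤-trans s≤s' s'≤p) a a∈F q at o par

  module _ {y : Vec Bool n} {F : Vars} {a₀ : ℕ} (a₀∈F : a₀ ∈ F) (a₀<n : a₀ < n) where

    -- The parity is not constant on a subcube with a free variable, so X
    -- cannot halt there before it has tested one.
    no-early-halt : ∀ {s o} → ParityOn s o y F → nth X s ≡ just halt → ⊥
    no-early-halt par at = parity-flip y a₀ a₀<n
      (trans (sym (halts-halt flipped at (par flipped inside))) (halts-halt y at (par y (centre y))))
      where
      flipped = assign y a₀ (not (inputVal y a₀))
      inside : InSubcube F y flipped
      inside j j∉F = assign-other y a₀ _ j (λ { refl → j∉F a₀∈F })

    mutual
      -- Following a terminating run on y (k is its length), X reaches a test
      -- of a free variable: every other instruction acts alike on the subcube.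
      first-free-test : ∀ k {s o st} → run X k (s , stateOf y o) ≡ just st → ParityOn s o y F → FreeTest s y F
      first-free-test (suc k) {s} h par = by-instruction k h par (nth X s) refl

      by-instruction : ∀ k {s o st} → run X (suc k) (s , stateOf y o) ≡ just st → ParityOn s o y F →
                       (mi : Maybe Instr) → nth X s ≡ mi → FreeTest s y F
      by-instruction k h par nothing at = ⊥-elim (halts-inaction y (step-nothing X at) (par y (centre y)))
      by-instruction k {s} {o} h par (just i) at with auxFree-at s isX at
      ... | stop         = ⊥-elim (no-early-halt par at)
      ... | goto zero    = ⊥-elim (halts-inaction y (step-jump0 X at) (par y (centre y)))
      ... | goto (suc l) = proceed k (m≤m+n s (suc l)) (λ _ _ → step-jump X at) h par
      ... | read j       = proceed k (n≤1+n s) (λ _ _ → step-plain X at) h par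
      ... | write v      = proceed k (n≤1+n s) (λ _ _ → step-plain X at) h par
      ... | test-out q v = proceed k (≤-next _ s) (λ _ _ → step-test X q at) h par
      ... | test-in q j with j ∈? F
      ...   | yes j∈F = freeTest s ≤-refl j j∈F q at o par
      ...   | no  j∉F = proceed k (≤-next _ s) reads-fixed h par
        where
        reads-fixed : ∀ x → InSubcube F y x →
                      step X (s , stateOf x o) ≡ continue (next (agree (inputVal y j) q) s , stateOf x o)
        reads-fixed x inx = trans (step-test X q at)
                                  (cong (λ r → continue (next (agree r q) s , stateOf x o)) (inx j j∉F))

      proceed : ∀ k {s o s' o' st} → s ≤ s' →
                (∀ x → InSubcube F y x → step X (s , stateOf x o) ≡ continue (s' , stateOf x o')) →
                run X (suc k) (s , stateOf y o) ≡ just st → ParityOn s o y F → FreeTest s y F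
      proceed k s≤s' uniform h par =
        later s≤s' (first-free-test k (trans (sym (run-continue X (uniform y (centre y)))) h)
                                      (parityOn-step {y = y} {F} uniform par))

  skip-free-test : ∀ {s y F} → Bounded n F → (ft : FreeTest s y F) →
                   let open FreeTest ft in
                   ParityOn (suc (suc pos)) output (assign y var (not polarity)) (F ─ var∈F)
  skip-free-test {y = y} {F} bound (freeTest t _ a a∈F q at o par) x inx =
    halts-continue x skips (par x inside)
    where
    xa : inputVal x a ≡ not q
    xa = trans (inx a (∉-remove id id a∈F)) (assign-same y a (not q) (bound a∈F))
    inside : InSubcube F y x
    inside j j∉F = trans (inx j (j∉F ∘ ∈-─⁻ a∈F)) (assign-other y a (not q) j (λ { refl → j∉F a∈F }))
    skips : step X (t , stateOf x o) ≡ continue (suc (suc t) , stateOf x o)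
    skips = trans (step-test X q at)
                  (cong (λ r → continue (next r t , stateOf x o))
                        (trans (cong (λ r → agree r q) xa) (agree-not q)))

-- Letters of an abstract machine with two Boolean inputs A and B:
-- `test v g` reads A (v = F) or B (v = T) and proceeds with the next letter
-- when the reply agrees with g, `set v g` writes v to the output and then
-- proceeds (g = T) or skips one letter (g = F), `jmp l` is a forward jump.
data Letter : Set where
  test : Bool → Bool → Letter
  set  : Bool → Bool → Letter
  jmp  : ℕ → Letter
  hlt  : Letter

pick : Bool → Bool → Bool → Bool
pick false va vb = va
pick true  va vb = vb

data Move : Set where
  halts : Bool → Move
  moves : ℕ → Bool → Move
  fails : Move

stepA : Letter → ℕ → Bool → Bool → Bool → Move
stepA (test v g)    p o va vb = moves (next (agree (pick v va vb) g) p) o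
stepA (set v g)     p o va vb = moves (next g p) v
stepA (jmp zero)    p o va vb = fails
stepA (jmp (suc l)) p o va vb = moves (suc l + p) o
stepA hlt           p o va vb = halts o

Prog : Set
Prog = ℕ → Maybe Letter

data Runs (Y : Prog) (va vb : Bool) : ℕ → Bool → Bool → Set where
  halt-here : ∀ {p o r ℓ} → Y p ≡ just ℓ → stepA ℓ p o va vb ≡ halts r → Runs Y va vb p o r
  move      : ∀ {p o r ℓ p' o'} → Y p ≡ just ℓ → stepA ℓ p o va vb ≡ moves p' o' →
              Runs Y va vb p' o' r → Runs Y va vb p o r

record Pending : Set where
  constructor pending
  field
    position : ℕ
    current  : Bool
    inA      : Bool
    inB      : Bool
open Pending

resolve : Bool → Bool → Bool → Move → List Pending → Maybe (List Pending)
resolve c va vb (halts r)   ps = if agree r (va xor vb xor c) then just ps else nothing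
resolve c va vb (moves p o) ps = if p <ᵇ 7 then just (pending p o va vb ∷ ps) else nothing
resolve c va vb fails       ps = nothing

advanceOne : Bool → Letter → ℕ → Pending → List Pending → Maybe (List Pending)
advanceOne c ℓ q (pending p o va vb) ps =
  if p ≡ᵇ q then resolve c va vb (stepA ℓ p o va vb) ps else just (pending p o va vb ∷ ps)

advance : Bool → Letter → ℕ → List Pending → Maybe (List Pending)
advance c ℓ q []       = just []
advance c ℓ q (x ∷ xs) = advance c ℓ q xs >>= advanceOne c ℓ q x

anyAt : ℕ → List Pending → Bool
anyAt q = any (λ x → position x ≡ᵇ q)

-- All letters that can matter in a program of 7 letters, listed
-- explicitly so that the search below evaluates quickly.
alphabet : List Letter
alphabet = test false false ∷ test false true ∷ test true false ∷ test true true ∷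
           set false false ∷ set false true ∷ set true false ∷ set true true ∷
           hlt ∷ jmp 0 ∷ jmp 1 ∷ jmp 2 ∷ jmp 3 ∷ jmp 4 ∷ jmp 5 ∷ jmp 6 ∷ []

bools : List Bool
bools = false ∷ true ∷ []

alphabet-spec : alphabet ≡ cartesianProductWith test bools bools ++ cartesianProductWith set bools bools ++
                          hlt ∷ map jmp (upTo 7)
alphabet-spec = refl

mutual
  -- `search c f q ps`: can the positions q, q+1, … (f of them remain) be
  -- filled with letters so that all pending runs halt correctly?
  -- Positions reached by no pending run are skipped.
  search : Bool → ℕ → ℕ → List Pending → Bool
  search c f       q []            = true
  search c zero    q (_ ∷ _)       = false
  search c (suc f) q ps@(_ ∷ _)    =
    if anyAt q ps then any (λ ℓ → searchAfter c f q (advance c ℓ q ps)) alphabet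
    else search c f (suc q) ps

  searchAfter : Bool → ℕ → ℕ → Maybe (List Pending) → Bool
  searchAfter c f q nothing   = false
  searchAfter c f q (just ps) = search c f (suc q) ps

initial : Bool → List Pending
initial o = pending 0 o false false ∷ pending 0 o false true ∷
            pending 0 o true false ∷ pending 0 o true true ∷ []

searchFromTestA : Bool → Bool → Bool
searchFromTestA o c = searchAfter c 6 0 (advance c (test false true) 0 (initial o))

searchFromTestA-fails : ∀ o c → searchFromTestA o c ≡ false
searchFromTestA-fails false false = refl
searchFromTestA-fails false true  = refl
searchFromTestA-fails true  false = refl
searchFromTestA-fails true  true  = refl

stepA-forward : ∀ ℓ p o va vb {p' o'} → stepA ℓ p o va vb ≡ moves p' o' → p < p'
stepA-forward (test v g)    p o va vb refl with agree (pick v va vb) g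
... | true  = ≤-refl
... | false = n≤1+n (suc p)
stepA-forward (set v true)  p o va vb refl = ≤-refl
stepA-forward (set v false) p o va vb refl = n≤1+n (suc p)
stepA-forward (jmp (suc l)) p o va vb refl = s≤s (m≤n+m p l)

bool∈ : ∀ v → v ∈ˡ bools
bool∈ false = Any.here refl
bool∈ true  = Any.there (Any.here refl)

letter-cases : ∀ ℓ → ℓ ∈ˡ alphabet ⊎ ∃ λ l → ℓ ≡ jmp l × 7 ≤ l
letter-cases ℓ = Sum.map₁ (subst (ℓ ∈ˡ_) (sym alphabet-spec)) (structured ℓ)
  where
  tests sets : List Letter
  tests = cartesianProductWith test bools bools
  sets  = cartesianProductWith set bools bools
  structured : ∀ ℓ → ℓ ∈ˡ (tests ++ sets ++ hlt ∷ map jmp (upTo 7)) ⊎ ∃ λ l → ℓ ≡ jmp l × 7 ≤ l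
  structured (test v g) = inj₁ (∈-++⁺ˡ (∈-cartesianProductWith⁺ test (bool∈ v) (bool∈ g)))
  structured (set v g)  = inj₁ (∈-++⁺ʳ tests (∈-++⁺ˡ (∈-cartesianProductWith⁺ set (bool∈ v) (bool∈ g))))
  structured hlt        = inj₁ (∈-++⁺ʳ tests (∈-++⁺ʳ sets (Any.here refl)))
  structured (jmp l) with l <? 7
  ... | yes l<7 = inj₁ (∈-++⁺ʳ tests (∈-++⁺ʳ sets (Any.there (∈-map⁺ jmp (∈-upTo⁺ l<7)))))
  ... | no  l≮7 = inj₂ (l , refl , ≮⇒≥ l≮7)

module Completeness (Y : Prog) (bounded : ∀ {p ℓ} → Y p ≡ just ℓ → p < 7) (c : Bool) where

  Correct : Bool → Bool → ℕ → Bool → Set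
  Correct va vb p o = Runs Y va vb p o (va xor vb xor c)

  Accounted : ℕ → Pending → Set
  Accounted q (pending p o va vb) = q ≤ p × Correct va vb p o

  runs-letter : ∀ {va vb p o r} → Runs Y va vb p o r → ∃ λ ℓ → Y p ≡ just ℓ
  runs-letter (halt-here Yp _) = _ , Yp
  runs-letter (move Yp _ _)    = _ , Yp

  runs-bound : ∀ {va vb p o r} → Runs Y va vb p o r → p < 7
  runs-bound (halt-here Yp _) = bounded Yp
  runs-bound (move Yp _ _)    = bounded Yp

  no-long-jump : ∀ {va vb q o r l} → Y q ≡ just (jmp l) → 7 ≤ l → ¬ Runs Y va vb q o r
  no-long-jump {l = suc l} Yq _ (halt-here Yq' s) with trans (sym Yq) Yq'
  ... | refl with s
  ...   | ()
  no-long-jump {q = q} {l = suc l} Yq 7≤l (move Yq' s R) with trans (sym Yq) Yq'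
  ... | refl with s
  ...   | refl = <-irrefl refl (<-≤-trans (runs-bound R) (≤-trans 7≤l (m≤m+n (suc l) q)))

  -- The move given by the letter of Y at q is accepted by `resolve`, and the
  -- run stays accounted for, since runs move forward.
  resolve-good : ∀ {q ℓ va vb o ps} → Y q ≡ just ℓ → Correct va vb q o → All (Accounted (suc q)) ps →
                 ∃ λ ps' → resolve c va vb (stepA ℓ q o va vb) ps ≡ just ps' × All (Accounted (suc q)) ps'
  resolve-good {va = va} {vb} Yq (halt-here Yq' s) acc with trans (sym Yq) Yq'
  ... | refl rewrite s | agree-self (va xor vb xor c) = _ , refl , acc
  resolve-good {q} {ℓ} {va} {vb} {o} Yq (move {p' = p'} Yq' s R) acc with trans (sym Yq) Yq'
  ... | refl rewrite s with p' <ᵇ 7 | <⇒<ᵇ (runs-bound R)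
  ...   | true | _ = _ , refl , (stepA-forward ℓ q o va vb s , R) ∷ acc

  advanceOne-good : ∀ {q ℓ} x {ps} → Y q ≡ just ℓ → Accounted q x → All (Accounted (suc q)) ps →
                    ∃ λ ps' → advanceOne c ℓ q x ps ≡ just ps' × All (Accounted (suc q)) ps'
  advanceOne-good {q} (pending p o va vb) Yq (q≤p , R) acc with p ≡ᵇ q | ≡ᵇ⇒≡ p q | ≡⇒≡ᵇ p q
  ... | true  | p≡q | _ with p≡q _
  ...   | refl = resolve-good Yq R acc
  advanceOne-good (pending p o va vb) Yq (q≤p , R) acc | false | _ | p≢q =
    _ , refl , (≤∧≢⇒< q≤p (p≢q ∘ sym) , R) ∷ acc

  advance-good : ∀ {q ℓ} ps → Y q ≡ just ℓ → All (Accounted q) ps →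
                 ∃ λ ps' → advance c ℓ q ps ≡ just ps' × All (Accounted (suc q)) ps'
  advance-good []       Yq []          = [] , refl , []
  advance-good (x ∷ xs) Yq (acc ∷ accs) with advance-good xs Yq accs
  ... | ys , e , accs' rewrite e = advanceOne-good x Yq acc accs'

  idle-good : ∀ {q} ps → anyAt q ps ≡ false → All (Accounted q) ps → All (Accounted (suc q)) ps
  idle-good {q} ps idle accs = zipWith beyond (elsewhere , accs)
    where
    elsewhere : All (λ x → ¬ T (position x ≡ᵇ q)) ps
    elsewhere = ¬Any⇒All¬ ps (λ at → subst T idle (any⁺ _ at))
    beyond : ∀ {x} → ¬ T (position x ≡ᵇ q) × Accounted q x → Accounted (suc q) x
    beyond {pending p o va vb} (p≢q , q≤p , R) = ≤∧≢⇒< q≤p (p≢q ∘ ≡⇒≡ᵇ p q ∘ sym) , R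

  busy-run : ∀ {q} ps → T (anyAt q ps) → All (Accounted q) ps →
             ∃ λ va → ∃ λ vb → ∃ λ o → Correct va vb q o
  busy-run {q} (pending p o va vb ∷ ps) busy ((_ , R) ∷ accs) with p ≡ᵇ q | ≡ᵇ⇒≡ p q
  ... | true  | p≡q with p≡q _
  ...   | refl = va , vb , o , R
  busy-run (_ ∷ ps) busy (_ ∷ accs) | false | _ = busy-run ps busy accs

  mutual
    complete : ∀ f q ps → q + f ≡ 7 → All (Accounted q) ps → T (search c f q ps)
    complete f q [] _ _ = _
    complete zero q (pending p o va vb ∷ _) q+0≡7 ((q≤p , R) ∷ _) =
      <-irrefl refl (<-≤-trans (runs-bound R) (subst (_≤ p) (trans (sym (+-identityʳ q)) q+0≡7) q≤p))
    complete (suc f) q ps@(_ ∷ _) q+f≡7 accs with anyAt q ps in busy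
    ... | false = complete f (suc q) ps (trans (sym (+-suc q f)) q+f≡7) (idle-good ps busy accs)
    ... | true with busy-run ps (subst T (sym busy) _) accs
    ...   | _ , _ , _ , R with runs-letter R
    ...     | ℓ , Yq with letter-cases ℓ
    ...       | inj₂ (l , refl , 7≤l) = ⊥-elim (no-long-jump Yq 7≤l R)
    ...       | inj₁ ℓ∈ = any⁺ (λ ℓ′ → searchAfter c f q (advance c ℓ′ q ps))
                                 (Any.map (λ { refl → place ps q+f≡7 Yq accs }) ℓ∈)

    place : ∀ {f q ℓ} ps → q + suc f ≡ 7 → Y q ≡ just ℓ → All (Accounted q) ps →
            T (searchAfter c f q (advance c ℓ q ps))
    place {f} {q} ps q+f≡7 Yq accs with advance-good ps Yq accs
    ... | ps' , advanced , accs' rewrite advanced =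
      complete f (suc q) ps' (trans (sym (+-suc q f)) q+f≡7) accs'

  search-complete : ∀ o → Y 0 ≡ just (test false true) → (∀ va vb → Correct va vb 0 o) →
                    T (searchFromTestA o c)
  search-complete o Y0 correct =
    place (initial o) refl Y0 ((z≤n , correct false false) ∷ (z≤n , correct false true) ∷
                               (z≤n , correct true false) ∷ (z≤n , correct true true) ∷ [])

short-parity-impossible : ∀ (Y : Prog) → (∀ {p ℓ} → Y p ≡ just ℓ → p < 7) → Y 0 ≡ just (test false true) →
                          ∀ o c → ¬ (∀ va vb → Runs Y va vb 0 o (va xor vb xor c))
short-parity-impossible Y bounded Y0 o c correct =
  subst T (searchFromTestA-fails o c) (Completeness.search-complete Y bounded c o Y0 correct)

-- Abstraction of the seven instructions of X at positions t, …, t+6 as an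
-- abstract program: tests of the inputs a and b become tests of A and B
-- (a relative to the polarity q₀), a test of any other input j, whose value
-- is fixed to ρ j, becomes the jump it always takes.
module Window (X : InstrSeq) (isX : IS 0 X) (t a b : ℕ) (q₀ : Bool) (ρ : ℕ → Bool) where

  forward : Bool → Letter
  forward true  = jmp 1
  forward false = jmp 2

  -- The letters of tests, and of all instructions (instructions using
  -- auxiliary registers do not occur in X).
  letterOfRead : Bool → ℕ → Letter
  letterOfRead q j with j ≟ a | j ≟ b
  ... | yes _ | _     = test false (agree q q₀)
  ... | no  _ | yes _ = test true q
  ... | no  _ | no  _ = forward (agree (ρ j) q)

  letterOfTest : Bool → Basic → Letter
  letterOfTest q (inGet j)  = letterOfRead q j
  letterOfTest q (outSet v) = set v (agree v q)
  letterOfTest q _          = jmp 0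

  letterOf : Instr → Letter
  letterOf (plain (inGet _))  = jmp 1
  letterOf (plain (outSet v)) = set v true
  letterOf (plain _)          = jmp 0
  letterOf (ptest i)          = letterOfTest true i
  letterOf (ntest i)          = letterOfTest false i
  letterOf (jump l)           = jmp l
  letterOf halt               = hlt

  letterOf-Test : ∀ q i → letterOf (Test q i) ≡ letterOfTest q i
  letterOf-Test true  i = refl
  letterOf-Test false i = refl

  window : Prog
  window p = if p <ᵇ 7 then Maybe.map letterOf (nth X (t + p)) else nothing

  window-bounded : ∀ {p ℓ} → window p ≡ just ℓ → p < 7
  window-bounded {p} occupied with p <ᵇ 7 | <ᵇ⇒< p 7
  ... | true | p<7 = p<7 _

  window-at : ∀ {p i} → p < 7 → nth X (t + p) ≡ just i → window p ≡ just (letterOf i)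
  window-at {p} p<7 at with p <ᵇ 7 | <⇒<ᵇ p<7
  ... | true | _ rewrite at = refl

  window-start : nth X t ≡ just (Test q₀ (inGet a)) → window 0 ≡ just (test false true)
  window-start at = trans (window-at (s≤s z≤n) (trans (cong (nth X) (+-identityʳ t)) at))
                          (cong just (trans (letterOf-Test q₀ (inGet a)) tests-a))
    where
    tests-a : letterOfRead q₀ a ≡ test false true
    tests-a with a ≟ a
    ... | yes _   = cong (test false) (agree-self q₀)
    ... | no  a≢a = ⊥-elim (a≢a refl)

  module Simulation {n} (x : Vec Bool n) (va vb : Bool) (at-a : agree (inputVal x a) q₀ ≡ va)
                    (at-b : inputVal x b ≡ vb) (elsewhere : ∀ j → j ≢ a → j ≢ b → inputVal x j ≡ ρ j) where

    Mirrors : Outcome → Move → Set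
    Mirrors oc (halts r)   = oc ≡ halted (stateOf x r)
    Mirrors oc (moves p o) = oc ≡ continue (t + p , stateOf x o)
    Mirrors oc fails       = oc ≡ inaction

    moved : ∀ {o p₁ p₂} → p₁ ≡ p₂ → continue (p₁ , stateOf x o) ≡ continue (p₂ , stateOf x o)
    moved = cong (λ z → continue (z , _))

    mirror-read : ∀ {p o} q j → nth X (t + p) ≡ just (Test q (inGet j)) →
                  Mirrors (step X (t + p , stateOf x o)) (stepA (letterOfRead q j) p o va vb)
    mirror-read {p} {o} q j at with j ≟ a | j ≟ b
    ... | yes refl | _ = trans (step-test X q at)
      (moved (trans (cong (λ g → next g (t + p)) (trans (agree-relative (inputVal x a) q q₀)
                                                        (cong (λ v → agree v (agree q q₀)) at-a)))
                    (sym (+-next t _ p))))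
    ... | no _ | yes refl = trans (step-test X q at)
      (moved (trans (cong (λ v → next (agree v q) (t + p)) at-b) (sym (+-next t _ p))))
    ... | no j≢a | no j≢b = via-forward (agree (ρ j) q)
      (trans (step-test X q at) (moved (cong (λ v → next (agree v q) (t + p)) (elsewhere j j≢a j≢b))))
      where
      via-forward : ∀ {oc} g → oc ≡ continue (next g (t + p) , stateOf x o) →
                    Mirrors oc (stepA (forward g) p o va vb)
      via-forward true  e = trans e (moved (sym (+-next t true p)))
      via-forward false e = trans e (moved (sym (+-next t false p)))

    mirror : ∀ {p o i} → AuxFree i → nth X (t + p) ≡ just i →
             Mirrors (step X (t + p , stateOf x o)) (stepA (letterOf i) p o va vb)
    mirror stop           at = step-halt X at
    mirror (goto zero)    at = step-jump0 X at
    mirror {p} (goto (suc l)) at =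
      trans (step-jump X at) (moved (trans (+-assoc t p (suc l)) (cong (t +_) (+-comm p (suc l)))))
    mirror {p} (read j)   at = trans (step-plain X at) (moved (sym (+-suc t p)))
    mirror {p} (write v)  at = trans (step-plain X at) (moved (sym (+-suc t p)))
    mirror {p} (test-out q v) at rewrite letterOf-Test q (outSet v) =
      trans (step-test X q at) (moved (sym (+-next t (agree v q) p)))
    mirror (test-in q j) at rewrite letterOf-Test q (inGet j) = mirror-read q j at

    nothing≢just : ∀ {i : Instr} → nothing ≢ just i
    nothing≢just ()

    mutual
      simulate : length X ≤ t + 7 → ∀ k p o {st} → run X k (t + p , stateOf x o) ≡ just st →
                 Runs window va vb p o (out st)
      simulate short (suc k) p o h = simulate-at short k p o h (nth X (t + p)) refl

      simulate-at : length X ≤ t + 7 → ∀ k p o {st} → run X (suc k) (t + p , stateOf x o) ≡ just st →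
                    (mi : Maybe Instr) → nth X (t + p) ≡ mi → Runs window va vb p o (out st)
      simulate-at short k p o h nothing at with trans (sym (run-inaction X (step-nothing X at))) h
      ... | ()
      simulate-at short k p o h (just i) at with p <? 7
      ... | no p≮7 =
        ⊥-elim (nothing≢just (trans (sym (nth-beyond X (t + p) (≤-trans short (+-monoʳ-≤ t (≮⇒≥ p≮7))))) at))
      ... | yes p<7 = follow short k p o h (window-at p<7 at) _ refl (mirror (auxFree-at (t + p) isX at) at)

      follow : length X ≤ t + 7 → ∀ k p o {st ℓ} → run X (suc k) (t + p , stateOf x o) ≡ just st →
               window p ≡ just ℓ → (m : Move) → stepA ℓ p o va vb ≡ m →
               Mirrors (step X (t + p , stateOf x o)) m → Runs window va vb p o (out st)
      follow short k p o h Yp (halts r) e stepped with trans (sym (run-halted X stepped)) h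
      ... | refl = halt-here Yp e
      follow short k p o h Yp (moves p' o') e stepped =
        move Yp e (simulate short k p' o' (trans (sym (run-continue X stepped)) h))
      follow short k p o h Yp fails e stepped with trans (sym (run-inaction X stepped)) h
      ... | ()

module XorSolver = CommutativeMonoidSolver
  (CommutativeRing.+-commutativeMonoid xor-∧-commutativeRing)

module TwoInputs {n} (y : Vec Bool n) {a b : ℕ} (a<n : a < n) (b<n : b < n) (a≢b : a ≢ b) (q : Bool) where

  withA : Bool → Vec Bool n
  withA va = assign y a (agree va q)

  probe : Bool → Bool → Vec Bool n
  probe va vb = assign (withA va) b vb

  at-a : ∀ va vb → agree (inputVal (probe va vb) a) q ≡ va
  at-a va vb = trans (cong (λ v → agree v q) (trans (assign-other (withA va) b vb a a≢b)
                                                    (assign-same y a (agree va q) a<n)))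
                     (agree-involutive va q)

  at-b : ∀ va vb → inputVal (probe va vb) b ≡ vb
  at-b va vb = assign-same (withA va) b vb b<n

  elsewhere : ∀ va vb j → j ≢ a → j ≢ b → inputVal (probe va vb) j ≡ inputVal y j
  elsewhere va vb j j≢a j≢b =
    trans (assign-other (withA va) b vb j j≢b) (assign-other y a (agree va q) j j≢a)

  offset : Bool
  offset = parity y xor inputVal y a xor inputVal y b xor not q

  parity-probe : ∀ va vb → parity (probe va vb) ≡ va xor vb xor offset
  parity-probe va vb = begin
    parity (probe va vb)
      ≡⟨ parity-assign (withA va) b vb b<n ⟩
    parity (withA va) xor (inputVal (withA va) b xor vb)
      ≡⟨ cong₂ (λ u w → u xor (w xor vb)) (parity-assign y a (agree va q) a<n)
                                           (assign-other y a (agree va q) b (a≢b ∘ sym)) ⟩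
    (parity y xor (inputVal y a xor agree va q)) xor (inputVal y b xor vb)
      ≡⟨ cong (λ u → (parity y xor (inputVal y a xor u)) xor (inputVal y b xor vb)) (agree-xor va q) ⟩
    (parity y xor (inputVal y a xor (va xor not q))) xor (inputVal y b xor vb)
      ≡⟨ rearrange (parity y) (inputVal y a) (inputVal y b) va vb (not q) ⟩
    va xor vb xor offset ∎
    where
    open ≡-Reasoning
    rearrange : ∀ p ya yb va vb nq →
                (p xor (ya xor (va xor nq))) xor (yb xor vb) ≡ va xor vb xor (p xor ya xor yb xor nq)
    rearrange = XorSolver.solve 6
      (λ p ya yb va vb nq → (p ⊕ (ya ⊕ (va ⊕ nq))) ⊕ (yb ⊕ vb) ⊜ va ⊕ vb ⊕ (p ⊕ ya ⊕ yb ⊕ nq)) refl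
      where open XorSolver

module LowerBound (X : InstrSeq) (isX : IS 0 X) {n : ℕ} where
  open Subcubes X isX {n}

  -- If X tests a free variable a at t and stops before t + 8, it cannot
  -- compute parity on a subcube with a second free variable b: the seven
  -- instructions from t would form an abstract program for xor.
  window-too-short : ∀ {t o y F} a b q → a ∈ F → b ∈ F → a ≢ b → Bounded n F →
                     nth X t ≡ just (Test q (inGet a)) → ParityOn t o y F → ¬ (length X ≤ t + 7)
  window-too-short {t} {o} {y} {F} a b q a∈F b∈F a≢b bound at par short =
    short-parity-impossible window window-bounded (window-start at) o offset correct
    where
    open Window X isX t a b q (inputVal y)
    open TwoInputs y (bound a∈F) (bound b∈F) a≢b q

    inside : ∀ va vb → InSubcube F y (probe va vb)
    inside va vb j j∉F = elsewhere va vb j (λ { refl → j∉F a∈F }) (λ { refl → j∉F b∈F })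

    correct : ∀ va vb → Runs window va vb 0 o (va xor vb xor offset)
    correct va vb with par (probe va vb) (inside va vb)
    ... | k , st , h , result =
      subst (Runs window va vb 0 o) (trans result (parity-probe va vb))
        (Simulation.simulate (probe va vb) va vb (at-a va vb) (at-b va vb) (elsewhere va vb) short k 0 o
          (subst (λ p → run X k (p , stateOf (probe va vb) o) ≡ just st) (sym (+-identityʳ t)) h))

  free-test : ∀ {m s o y F} → Fresh.length F ≡ suc m → Bounded n F → ParityOn s o y F → FreeTest s y F
  free-test {y = y} {F = cons a₀ _ _} _ bound par with par y (centre y)
  ... | k , _ , h , _ = first-free-test (here refl) (bound (here refl)) k h par

  two-free : ∀ {s o y F} → Fresh.length F ≡ 2 → Bounded n F → ParityOn s o y F → s + 8 ≤ length X
  two-free {s} {y = y} {F} size bound par with free-test {y = y} size bound par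
  ... | freeTest t s≤t a a∈F q at _ par' with another F size a∈F | t + 8 ≤? length X
  ...   | _ | yes long = ≤-trans (+-monoˡ-≤ 8 s≤t) long
  ...   | b , b∈F , a≢b | no ¬long =
    ⊥-elim (window-too-short {y = y} a b q a∈F b∈F a≢b bound at par'
             (≤-pred (subst (suc (length X) ≤_) (+-suc t 7) (≰⇒> ¬long))))

  -- Each further free variable costs two more instructions: after the first
  -- free test, fixing its variable to skip, the rest starts two positions on.
  parity-cost : ∀ m {s o y F} → Fresh.length F ≡ m + 2 → Bounded n F → ParityOn s o y F →
                s + (2 * m + 8) ≤ length X
  parity-cost zero {y = y} size bound par = two-free {y = y} size bound par
  parity-cost (suc m) {s} {y = y} {F} size bound par with free-test {y = y} size bound par
  ... | ft@(freeTest t s≤t a a∈F q at o' par') = begin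
    s + (2 * suc m + 8)          ≡⟨ two-more s m ⟩
    suc (suc (s + (2 * m + 8)))  ≤⟨ s≤s (s≤s (+-monoˡ-≤ (2 * m + 8) s≤t)) ⟩
    suc (suc t) + (2 * m + 8)    ≤⟨ parity-cost m {y = assign y a (not q)} smaller (bound ∘ ∈-─⁻ a∈F)
                                                 (skip-free-test {y = y} bound ft) ⟩
    length X                     ∎
    where
    open ≤-Reasoning
    smaller : Fresh.length (F ─ a∈F) ≡ m + 2
    smaller = suc-injective (trans (sym (length-remove a∈F)) size)
    two-more : ∀ s m → s + (2 * suc m + 8) ≡ suc (suc (s + (2 * m + 8)))
    two-more = solve-∀

-- A program in IS⁰ computing the parity of m + 2 inputs has at least
-- 2m + 8 instructions, one more than 2(m + 2) + 3.
parity-lower-bound : ∀ m X → IS 0 X → Computes X (parity {m + 2}) → 2 * m + 8 ≤ length X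
parity-lower-bound m X isX computes =
  LowerBound.parity-cost X isX m {y = replicate (m + 2) false}
    (length-below (m + 2)) (below-bound (m + 2)) (λ x _ → computes x)

parityFrom : (ℕ → Bool) → ℕ → ℕ → Bool
parityFrom ι i zero    = false
parityFrom ι i (suc m) = ι i xor parityFrom ι (suc i) m

parityFrom-suc : ∀ ι i m → parityFrom ι (suc i) m ≡ parityFrom (λ j → ι (suc j)) i m
parityFrom-suc ι i zero    = refl
parityFrom-suc ι i (suc m) = cong (ι (suc i) xor_) (parityFrom-suc ι (suc i) m)

parityFrom-inputVal : ∀ {n} (x : Vec Bool n) → parityFrom (inputVal x) 0 n ≡ parity x
parityFrom-inputVal []       = refl
parityFrom-inputVal {suc n} (x ∷ xs) =
  cong (x xor_) (trans (parityFrom-suc (inputVal (x ∷ xs)) 0 n) (parityFrom-inputVal xs))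

parityProgram : ℕ → ℕ → InstrSeq
parityProgram zero    i = ptest (auxGet 0) ∷ plain (outSet true) ∷ halt ∷ []
parityProgram (suc m) i = ptest (inGet i) ∷ plain (auxCom 0) ∷ parityProgram m (suc i)

length-parityProgram : ∀ m i → length (parityProgram m i) ≡ linBound m
length-parityProgram zero    i = refl
length-parityProgram (suc m) i =
  trans (cong (λ l → suc (suc l)) (length-parityProgram m (suc i))) (two-more m)
  where
  two-more : ∀ m → suc (suc (2 * m + 3)) ≡ 2 * suc m + 3
  two-more = solve-∀

parityProgram-IS¹ : ∀ m i → IS 1 (parityProgram m i)
parityProgram-IS¹ zero    i = s≤s z≤n ∷ _ ∷ _ ∷ []
parityProgram-IS¹ (suc m) i = _ ∷ s≤s z≤n ∷ parityProgram-IS¹ m (suc i)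

shift : Outcome → Outcome
shift (continue (p , s)) = continue (suc p , s)
shift oc                 = oc

step-shift : ∀ u Z p s → step (u ∷ Z) (suc p , s) ≡ shift (step Z (p , s))
step-shift u Z p s with nth Z p
... | nothing = refl
... | just (plain a) = refl
... | just (ptest a) with execBasic a s
...   | _ , true  = refl
...   | _ , false = refl
step-shift u Z p s | just (ntest a) with execBasic a s
...   | _ , true  = refl
...   | _ , false = refl
step-shift u Z p s | just (jump zero)    = refl
step-shift u Z p s | just (jump (suc l)) = refl
step-shift u Z p s | just halt           = refl

run-shift : ∀ u Z k p s → run (u ∷ Z) k (suc p , s) ≡ run Z k (p , s)
run-shift u Z zero    p s = refl
run-shift u Z (suc k) p s rewrite step-shift u Z p s with step Z (p , s)
... | halted _          = refl
... | continue (p' , s') = run-shift u Z k p' s'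
... | inaction          = refl

parityProgram-halts : ∀ m i ι f → ∃ λ k → ∃ λ st →
                      run (parityProgram m i) k (0 , mkState ι false f) ≡ just st ×
                      out st ≡ f 0 xor parityFrom ι i m
parityProgram-halts zero i ι f = copy (f 0) refl
  where
  copy : ∀ v → f 0 ≡ v → ∃ λ k → ∃ λ st →
         run (parityProgram zero i) k (0 , mkState ι false f) ≡ just st × out st ≡ f 0 xor false
  copy true  e = 3 , mkState ι true f , ran , sym (cong (_xor false) e)
    where ran : run (parityProgram zero i) 3 (0 , mkState ι false f) ≡ just (mkState ι true f)
          ran rewrite e = refl
  copy false e = 2 , mkState ι false f , ran , sym (cong (_xor false) e)
    where ran : run (parityProgram zero i) 2 (0 , mkState ι false f) ≡ just (mkState ι false f)
          ran rewrite e = refl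
parityProgram-halts (suc m) i ι f = by-input (ι i) refl
  where
  by-input : ∀ v → ι i ≡ v → ∃ λ k → ∃ λ st →
             run (parityProgram (suc m) i) k (0 , mkState ι false f) ≡ just st ×
             out st ≡ f 0 xor parityFrom ι i (suc m)
  by-input true e with parityProgram-halts m (suc i) ι (updAux f 0 (not (f 0)))
  ... | k , st , ran , result = suc (suc k) , st , ran' , trans result flipped
    where
    ran' : run (parityProgram (suc m) i) (suc (suc k)) (0 , mkState ι false f) ≡ just st
    ran' rewrite e = trans (run-shift _ _ k 1 _) (trans (run-shift _ _ k 0 _) ran)
    flipped : not (f 0) xor parityFrom ι (suc i) m ≡ f 0 xor ι i xor parityFrom ι (suc i) m
    flipped rewrite e = trans (sym (not-distribˡ-xor (f 0) _)) (not-distribʳ-xor (f 0) _)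
  by-input false e with parityProgram-halts m (suc i) ι f
  ... | k , st , ran , result =
    suc k , st , ran' , trans result (cong (λ v → f 0 xor v xor parityFrom ι (suc i) m) (sym e))
    where
    ran' : run (parityProgram (suc m) i) (suc k) (0 , mkState ι false f) ≡ just st
    ran' rewrite e = trans (run-shift _ _ k 1 _) (trans (run-shift _ _ k 0 _) ran)

parityProgram-computes : ∀ n → Computes (parityProgram n 0) (parity {n})
parityProgram-computes n x with parityProgram-halts n 0 (inputVal x) (λ _ → false)
... | k , st , ran , result = k , st , ran , trans result (parityFrom-inputVal x)

auxOK-mono : ∀ {k k'} → k ≤ k' → ∀ a → auxOK k a → auxOK k' a
auxOK-mono k≤k' (inGet _)    ok = ok
auxOK-mono k≤k' (outSet _)   ok = ok
auxOK-mono k≤k' (auxGet _)   j<k = <-≤-trans j<k k≤k'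
auxOK-mono k≤k' (auxSet _ _) j<k = <-≤-trans j<k k≤k'
auxOK-mono k≤k' (auxCom _)   j<k = <-≤-trans j<k k≤k'

InstrOK-mono : ∀ {k k'} → k ≤ k' → ∀ i → InstrOK k i → InstrOK k' i
InstrOK-mono k≤k' (plain a) = auxOK-mono k≤k' a
InstrOK-mono k≤k' (ptest a) = auxOK-mono k≤k' a
InstrOK-mono k≤k' (ntest a) = auxOK-mono k≤k' a
InstrOK-mono k≤k' (jump _)  ok = ok
InstrOK-mono k≤k' halt      ok = ok

IS-mono : ∀ {k k'} → k ≤ k' → ∀ X → IS k X → IS k' X
IS-mono k≤k' X = All.map (λ {i} → InstrOK-mono k≤k' i)

B-mono : ∀ {I J : InstrSeq → Set} g → (∀ X → I X → J X) → ∀ fam → B I g fam → B J g fam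
B-mono g I⊆J fam (h , eventually , programs) =
  h , eventually , λ n → let (X , inI , computes , short) = programs n in
                        X , I⊆J X inI , computes , short

parity-in-IS¹ : B (IS 1) linBound (λ n → parity)
parity-in-IS¹ = linBound , (0 , λ _ _ → ≤-refl) ,
  λ n → parityProgram n 0 , parityProgram-IS¹ n 0 , parityProgram-computes n ,
        ≤-reflexive (length-parityProgram n 0)

one-too-many : ∀ N → 2 * N + 8 ≡ suc (2 * (N + 2) + 3)
one-too-many = solve-∀

-- Parity is not in IS⁰:B(2n+3): for N beyond the threshold, a program for
-- N + 2 inputs would need 2N + 8 instructions but may have only 2N + 7.
parity-not-in-IS⁰ : ¬ B (IS 0) linBound (λ n → parity)
parity-not-in-IS⁰ (h , (N , eventually) , programs) with programs (N + 2)
... | X , isX , computes , short = 1+n≰n (begin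
  suc (linBound (N + 2))   ≡⟨ one-too-many N ⟨
  2 * N + 8                ≤⟨ parity-lower-bound N X isX computes ⟩
  length X                 ≤⟨ short ⟩
  h (N + 2)                ≤⟨ eventually (N + 2) (m≤m+n N 2) ⟩
  linBound (N + 2)         ∎)
  where open ≤-Reasoning

corollary1 : B (IS 0) linBound ⊊ B (IS 1) linBound
corollary1 = B-mono linBound (IS-mono z≤n) , (λ n → parity) , parity-in-IS¹ , parity-not-in-IS⁰
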